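{- Let $k,r\ge 2$ and let $H$ be a $k$-graph on $n$ vertices such that for every $x,y\in V(H)$ there are at least $k^2$ pairwise vertex-disjoint $(k-1)$-sets in $N(x)\cap N(y)$. Suppose $H$ has an $r$-edge-colouring with at least one edge of each colour and with no switcher of order at most $k^2+k$. Then $H\in\mathcal F^\ast_{k,r}$.
   Context: A $k$-graph $H$ has vertex set $V(H)$ and edges which are $k$-subsets of $V(H)$. For $x\in V(H)$, $N(x)$ is the set of $(k-1)$-sets $Y$ such that $\{x\}\cup Y\in E(H)$. Given an $r$-edge-colouring $c:E(H)\to[r]$, an $i$-switcher is the union of two matchings $M_1,M_2\subseteq E(H)$ with $V(M_1)=V(M_2)$ (the vertex sets they cover) such that $M_1$ has more edges of colour $i$ than $M_2$; its order is $|V(M_1)|$; a switcher is an $i$-switcher for some $i\in[r]$. Given a partition $\{V_1,\dots,V_r\}$ of $V(H)$, an edge $e$ has type $(j_1,\dots,j_r)$ if $|e\cap V_i|=j_i$ for all $i$; $\mathbf e_i$ is the $i$th standard unit vector of $\mathbb Z^r$. A pair $(\mathbf j,\sigma)$ with $\mathbf j\in\mathbb N_0^r$, $\sigma\in\{ -1,1\}$ is $k$-valid if $\sigma+\sum_i j_i=k$ and $j_i+\sigma\ge0$ for all $i$. An $r$-edge-coloured $k$-graph $H$ belongs to $\mathcal F^\ast_{k,r}$ if there exist a $k$-valid pair $(\mathbf j,\sigma)$ and a partition $\{V_1,\dots,V_r\}$ of $V(H)$ such that for each $i\in[r]$, every edge of colour $i$ has type $\mathbf j+\sigma\mathbf e_i$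 with respect to $(V_1,\dots,V_r)$. -}

module Defs where

open import Data.Nat as ℕ using (ℕ; _≤_; _<_; _*_; _+_)
open import Data.Integer as ℤ using (ℤ; +_; 0ℤ; 1ℤ; -1ℤ)
open import Data.Fin using (Fin; _≟_)
open import Data.Fin.Subset using (Subset; _∩_; _∪_; ⁅_⁆; ⋃; ∣_∣; Empty)
open import Data.Vec using (tabulate; sum)
open import Data.List using (List; length; filter)
open import Data.List.Relation.Unary.All using (All)
open import Data.List.Relation.Unary.AllPairs using (AllPairs)
open import Data.Product using (Σ; ∃; _×_)
open import Data.Sum using (_⊎_)
open import Relation.Nullary using (¬_; ⌊_⌋; yes; no)
open import Relation.Binary.PropositionalEquality using (_≡_)

record KGraph (k n : ℕ) : Set₁ where
  field
    Edge    : Subset n → Set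
    uniform : ∀ e → Edge e → ∣ e ∣ ≡ k
open KGraph public

Disjoint : ∀ {n} → Subset n → Subset n → Set
Disjoint p q = Empty (p ∩ q)

InNbhd : ∀ {k n} → KGraph k n → Fin n → Subset n → Set
InNbhd {k} H x Y = (∣ Y ∣ ≡ k ℕ.∸ 1) × Edge H (⁅ x ⁆ ∪ Y)

-- an r-edge-colouring (values off the edge set are irrelevant)
Colouring : ℕ → ℕ → Set
Colouring n r = Subset n → Fin r

IsMatching : ∀ {k n} → KGraph k n → List (Subset n) → Set
IsMatching H M = All (Edge H) M × AllPairs Disjoint M

cover : ∀ {n} → List (Subset n) → Subset n
cover = ⋃

colourCount : ∀ {n r} → Colouring n r → Fin r → List (Subset n) → ℕ
colourCount c i M = length (filter (λ e → c e ≟ i) M)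

-- an i-switcher given by the pair of matchings (M₁ , M₂); its order is ∣ V(M₁) ∣
IsSwitcher : ∀ {k n r} → KGraph k n → Colouring n r → Fin r →
             List (Subset n) → List (Subset n) → Set
IsSwitcher H c i M₁ M₂ =
  IsMatching H M₁ × IsMatching H M₂ × cover M₁ ≡ cover M₂ ×
  colourCount c i M₂ < colourCount c i M₁

NoSwitcherUpTo : ∀ {k n r} → KGraph k n → Colouring n r → ℕ → Set
NoSwitcherUpTo H c m = ∀ i M₁ M₂ → IsSwitcher H c i M₁ M₂ → ¬ (∣ cover M₁ ∣ ≤ m)

-- V_i for a partition given as a part-assignment Fin n → Fin r
part : ∀ {n r} → (Fin n → Fin r) → Fin r → Subset n
part π i = tabulate (λ v → ⌊ π v ≟ i ⌋)

KValid : ∀ {r} → ℕ → (Fin r → ℕ) → ℤ → Set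
KValid k j σ = (σ ≡ 1ℤ ⊎ σ ≡ -1ℤ) ×
               (σ ℤ.+ + sum (tabulate j) ≡ + k) ×
               (∀ i → 0ℤ ℤ.≤ + j i ℤ.+ σ)

shifted : ∀ {r} → (Fin r → ℕ) → ℤ → Fin r → Fin r → ℤ
shifted j σ i l with i ≟ l
... | yes _ = + j l ℤ.+ σ
... | no  _ = + j l

HasType : ∀ {n r} → (Fin n → Fin r) → Subset n → (Fin r → ℤ) → Set
HasType π e t = ∀ l → + ∣ e ∩ part π l ∣ ≡ t l

InFstar : ∀ {k n r} → KGraph k n → Colouring n r → Set
InFstar {k} {n} {r} H c =
  Σ (Fin r → ℕ) λ j → Σ ℤ λ σ → Σ (Fin n → Fin r) λ π →
    KValid k j σ ×
    (∀ i e → Edge H e → c e ≡ i → HasType π e (shifted j σ i))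

{-# OPTIONS --safe #-}
module Submission where

-- Since H has no switcher of order at most k² + k, two matchings of at most k + 1 edges
-- covering the same vertices contain equally many edges of each colour. For a common
-- neighbourhood Y of x and y, trading the edge x ∪ Y for y ∪ Y therefore changes the colour
-- vector by δ(x, y) = 𝐞_c(x ∪ Y) − 𝐞_c(y ∪ Y) independently of Y, and δ is additive:
-- δ(x, y) = δ(x, z) + δ(z, y). The vectors δ(x, w) for a fixed w are of the form 𝐞_a − 𝐞_b and
-- so are their differences; the nonzero ones then all share their head or all share their
-- tail, which yields a sign σ and a map π from vertices to colours with
-- δ(x, y) = σ (𝐞_π(x) − 𝐞_π(y)). Finally, pairing e ∖ f with f ∖ e through disjoint common
-- neighbourhoods switches any edge e to any edge f, so that 𝐞_c(e) − 𝐞_c(f) = σ (t(e) − t(f))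
-- where t is the type with respect to the partition π; hence t(e) − σ 𝐞_c(e) is one vector j
-- for all edges e.

import Algebra.Solver.IdempotentCommutativeMonoid as ICM
open import Data.Bool.Base using (true; false; if_then_else_)
open import Data.Empty using (⊥-elim)
open import Data.Fin.Base using (Fin; zero; suc; punchIn)
open import Data.Fin.Properties as Fin using (_≟_; all?; ¬∀⟶∃¬; punchInᵢ≢i)
open import Data.Fin.Subset
open import Data.Fin.Subset.Properties
open import Data.Integer.Base as ℤ using (ℤ; +_; 0ℤ; 1ℤ; -1ℤ)
import Data.Integer.Properties as ℤ
open import Data.Integer.Tactic.RingSolver using (solve-∀)
open import Algebra.Properties.Semiring.Sum ℤ.+-*-semiring
  using (sum-syntax; ∑-distrib-+; *-distribˡ-sum; sum-cong-≗; sum-replicate-zero)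
open import Data.List.Base using (List; []; _∷_; length; map)
open import Data.List.Membership.Propositional using () renaming (_∈_ to _∈ₗ_)
open import Data.List.Membership.Propositional.Properties using (∈-map⁻)
open import Data.List.Properties using (length-map; map-∘)
open import Data.List.Relation.Unary.All as All using (All; []; _∷_)
import Data.List.Relation.Unary.All.Properties as All
open import Data.List.Relation.Unary.AllPairs as AllPairs using (AllPairs; []; _∷_)
import Data.List.Relation.Unary.AllPairs.Properties as AllPairs
open import Data.List.Relation.Unary.Any using (here; there)
open import Data.List.Relation.Unary.Unique.Propositional using (Unique)
import Data.List.Relation.Unary.Unique.Propositional.Properties as Unique
open import Data.Nat.Base using (ℕ; zero; suc; _+_; _*_; _≤_; _<_; z≤n; s≤s)
open import Data.Nat.ListAction using (sum)
open import Data.Nat.Properties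
  using (+-suc; +-comm; +-assoc; +-identityʳ; *-suc; m≤m+n; m≤n+m; n≤1+n; 1+n≰n; suc-injective;
         ≤-trans; ≤-reflexive; <-≤-trans; ≤-<-trans; <-cmp; +-mono-≤; +-monoˡ-≤; +-monoʳ-≤;
         *-mono-≤; *-monoˡ-≤; +-cancelˡ-≤; +-cancelˡ-≡; module ≤-Reasoning)
open import Data.Product using (Σ; ∃; ∃₂; _×_; _,_; proj₁; proj₂)
open import Data.Sum using (_⊎_; inj₁; inj₂; [_,_])
open import Data.Vec.Base as Vec using ([]; _∷_; here; there)
open import Function.Base using (_∘_; id)
open import Relation.Binary.Definitions using (tri<; tri≈; tri>)
open import Relation.Binary.PropositionalEquality hiding ([_])
open import Relation.Nullary using (yes; no; does)
open import Relation.Nullary.Decidable using (dec-true; dec-false; _⊎-dec_)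

open import Defs

private variable
  n : ℕ
  x y : Fin n
  p p′ q q′ s : Subset n

-- Finite sets

∣p∪q∣+∣p∩q∣ : ∀ (p q : Subset n) → ∣ p ∪ q ∣ + ∣ p ∩ q ∣ ≡ ∣ p ∣ + ∣ q ∣
∣p∪q∣+∣p∩q∣ []          []          = refl
∣p∪q∣+∣p∩q∣ (true  ∷ p) (true  ∷ q) =
  cong suc (trans (+-suc _ _) (trans (cong suc (∣p∪q∣+∣p∩q∣ p q)) (sym (+-suc _ _))))
∣p∪q∣+∣p∩q∣ (true  ∷ p) (false ∷ q) = cong suc (∣p∪q∣+∣p∩q∣ p q)
∣p∪q∣+∣p∩q∣ (false ∷ p) (true  ∷ q) = trans (cong suc (∣p∪q∣+∣p∩q∣ p q)) (sym (+-suc _ _))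
∣p∪q∣+∣p∩q∣ (false ∷ p) (false ∷ q) = ∣p∪q∣+∣p∩q∣ p q

∣p∪q∣≤∣p∣+∣q∣ : ∀ (p q : Subset n) → ∣ p ∪ q ∣ ≤ ∣ p ∣ + ∣ q ∣
∣p∪q∣≤∣p∣+∣q∣ p q = ≤-trans (m≤m+n _ _) (≤-reflexive (∣p∪q∣+∣p∩q∣ p q))

∣p∣≡∣p∩q∣+∣p─q∣ : ∀ (p q : Subset n) → ∣ p ∣ ≡ ∣ p ∩ q ∣ + ∣ p ─ q ∣
∣p∣≡∣p∩q∣+∣p─q∣ []          []          = refl
∣p∣≡∣p∩q∣+∣p─q∣ (true  ∷ p) (true  ∷ q) = cong suc (∣p∣≡∣p∩q∣+∣p─q∣ p q)
∣p∣≡∣p∩q∣+∣p─q∣ (true  ∷ p) (false ∷ q) = trans (cong suc (∣p∣≡∣p∩q∣+∣p─q∣ p q)) (sym (+-suc _ _))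
∣p∣≡∣p∩q∣+∣p─q∣ (false ∷ p) (true  ∷ q) = ∣p∣≡∣p∩q∣+∣p─q∣ p q
∣p∣≡∣p∩q∣+∣p─q∣ (false ∷ p) (false ∷ q) = ∣p∣≡∣p∩q∣+∣p─q∣ p q

∣⊥∩p∣≡0 : ∀ (p : Subset n) → ∣ ⊥ ∩ p ∣ ≡ 0
∣⊥∩p∣≡0 {n} p = trans (cong ∣_∣ (∩-zeroˡ p)) (∣⊥∣≡0 n)

∣p∣≡suc⇒Nonempty : ∀ (p : Subset n) {m} → ∣ p ∣ ≡ suc m → Nonempty p
∣p∣≡suc⇒Nonempty {n} p ∣p∣≡suc with nonempty? p
... | yes p≢∅ = p≢∅
... | no  p≡∅ with () ← trans (sym ∣p∣≡suc) (trans (cong ∣_∣ (Empty-unique p≡∅)) (∣⊥∣≡0 n))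

x∈p─q⇒x∉q : ∀ (p q : Subset n) → x ∈ p ─ q → x ∉ q
x∈p─q⇒x∉q (_ ∷ p) (false ∷ q) here       ()
x∈p─q⇒x∉q (_ ∷ p) (_     ∷ q) (there x∈) (there x∈q) = x∈p─q⇒x∉q p q x∈ x∈q

∣⁅x⁆∪p∣≤suc∣p∣ : ∀ x (p : Subset n) → ∣ ⁅ x ⁆ ∪ p ∣ ≤ suc ∣ p ∣
∣⁅x⁆∪p∣≤suc∣p∣ x p = ≤-trans (∣p∪q∣≤∣p∣+∣q∣ ⁅ x ⁆ p) (≤-reflexive (cong (_+ ∣ p ∣) (∣⁅x⁆∣≡1 x)))

x∉⁅y⁆∪p : x ≢ y → x ∉ p → x ∉ ⁅ y ⁆ ∪ p
x∉⁅y⁆∪p {y = y} {p = p} x≢y x∉p x∈ = [ x≢y⇒x∉⁅y⁆ x≢y , x∉p ] (x∈p∪q⁻ ⁅ y ⁆ p x∈)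

p∪[q─p]≡p∪q : ∀ (p q : Subset n) → p ∪ (q ─ p) ≡ p ∪ q
p∪[q─p]≡p∪q []          []      = refl
p∪[q─p]≡p∪q (true  ∷ p) (_ ∷ q) = cong (true ∷_) (p∪[q─p]≡p∪q p q)
p∪[q─p]≡p∪q (false ∷ p) (b ∷ q) = cong (b ∷_) (p∪[q─p]≡p∪q p q)

Disjoint⁺ : (∀ {x} → x ∈ p → x ∉ q) → Disjoint p q
Disjoint⁺ {p = p} {q} p⟂q (_ , x∈p∩q) = let x∈p , x∈q = x∈p∩q⁻ p q x∈p∩q in p⟂q x∈p x∈q

Disjoint⁻ : Disjoint p q → x ∈ p → x ∉ q
Disjoint⁻ p⟂q x∈p x∈q = p⟂q (_ , x∈p∩q⁺ (x∈p , x∈q))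

Disjoint-sym : Disjoint p q → Disjoint q p
Disjoint-sym p⟂q = Disjoint⁺ λ x∈q x∈p → Disjoint⁻ p⟂q x∈p x∈q

Disjoint-mono : p ⊆ p′ → q ⊆ q′ → Disjoint p′ q′ → Disjoint p q
Disjoint-mono p⊆p′ q⊆q′ p′⟂q′ = Disjoint⁺ λ x∈p x∈q → Disjoint⁻ p′⟂q′ (p⊆p′ x∈p) (q⊆q′ x∈q)

Disjoint-∪ˡ : Disjoint p s → Disjoint q s → Disjoint (p ∪ q) s
Disjoint-∪ˡ {p = p} {q = q} p⟂s q⟂s =
  Disjoint⁺ λ x∈p∪q → [ Disjoint⁻ p⟂s , Disjoint⁻ q⟂s ] (x∈p∪q⁻ p q x∈p∪q)

Disjoint-∪ʳ : Disjoint s p → Disjoint s q → Disjoint s (p ∪ q)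
Disjoint-∪ʳ s⟂p s⟂q = Disjoint-sym (Disjoint-∪ˡ (Disjoint-sym s⟂p) (Disjoint-sym s⟂q))

Disjoint-⁅⁆ : x ∉ s → Disjoint ⁅ x ⁆ s
Disjoint-⁅⁆ {x = x} {s = s} x∉s = Disjoint⁺ λ y∈⁅x⁆ → subst (_∉ s) (sym (x∈⁅y⁆⇒x≡y x y∈⁅x⁆)) x∉s

Disjoint-⊥ : Disjoint ⊥ s
Disjoint-⊥ = Disjoint⁺ λ x∈⊥ → ⊥-elim (∉⊥ x∈⊥)

Disjoint-∖ : x ∉ p → Disjoint p (q - x) → Disjoint p q
Disjoint-∖ {x = x} x∉p p⟂q-x = Disjoint⁺ λ y∈p y∈q →
  Disjoint⁻ p⟂q-x y∈p (x∈p∧x≢y⇒x∈p-y y∈q λ { refl → x∉p y∈p })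

Disjoint-⋃⁺ : ∀ {ps : List (Subset n)} → All (Disjoint p) ps → Disjoint p (⋃ ps)
Disjoint-⋃⁺ []            = Disjoint-sym Disjoint-⊥
Disjoint-⋃⁺ (p⟂q ∷ p⟂ps) = Disjoint-∪ʳ p⟂q (Disjoint-⋃⁺ p⟂ps)

Disjoint-⋃⁻ : ∀ {ps : List (Subset n)} → Disjoint p (⋃ ps) → All (Disjoint p) ps
Disjoint-⋃⁻ {ps = []}     _         = []
Disjoint-⋃⁻ {ps = q ∷ ps} p⟂q∪⋃ps =
  Disjoint-mono ⊆-refl (p⊆p∪q _) p⟂q∪⋃ps ∷ Disjoint-⋃⁻ (Disjoint-mono ⊆-refl (q⊆p∪q q _) p⟂q∪⋃ps)

Disjoint⇒∣p∪q∣≡∣p∣+∣q∣ : Disjoint p q → ∣ p ∪ q ∣ ≡ ∣ p ∣ + ∣ q ∣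
Disjoint⇒∣p∪q∣≡∣p∣+∣q∣ {n} {p} {q} p⟂q = begin
  ∣ p ∪ q ∣               ≡⟨ +-identityʳ _ ⟨
  ∣ p ∪ q ∣ + 0           ≡⟨ cong (_+_ ∣ p ∪ q ∣) (∣⊥∣≡0 n) ⟨
  ∣ p ∪ q ∣ + ∣ ⊥ {n} ∣   ≡⟨ cong (λ s → ∣ p ∪ q ∣ + ∣ s ∣) (Empty-unique p⟂q) ⟨
  ∣ p ∪ q ∣ + ∣ p ∩ q ∣   ≡⟨ ∣p∪q∣+∣p∩q∣ p q ⟩
  ∣ p ∣ + ∣ q ∣           ∎
  where open ≡-Reasoning

∣⋃∣≤length*k : ∀ {k} {ps : List (Subset n)} → All (λ p → ∣ p ∣ ≡ k) ps → ∣ ⋃ ps ∣ ≤ length ps * k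
∣⋃∣≤length*k {n} []                        = ≤-reflexive (∣⊥∣≡0 n)
∣⋃∣≤length*k {ps = p ∷ _} (∣p∣≡k ∷ ∣ps∣≡k) =
  ≤-trans (∣p∪q∣≤∣p∣+∣q∣ p _) (+-mono-≤ (≤-reflexive ∣p∣≡k) (∣⋃∣≤length*k ∣ps∣≡k))

∣⋃∩s∣≡sum : ∀ {ps : List (Subset n)} → AllPairs Disjoint ps →
            ∣ ⋃ ps ∩ s ∣ ≡ sum (map (λ p → ∣ p ∩ s ∣) ps)
∣⋃∩s∣≡sum {s = s} {[]}     []                = ∣⊥∩p∣≡0 s
∣⋃∩s∣≡sum {s = s} {p ∷ ps} (p⟂ps ∷ ps-apart) = begin
  ∣ (p ∪ ⋃ ps) ∩ s ∣          ≡⟨ cong ∣_∣ (∩-distribʳ-∪ s p (⋃ ps)) ⟩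
  ∣ p ∩ s ∪ ⋃ ps ∩ s ∣        ≡⟨ Disjoint⇒∣p∪q∣≡∣p∣+∣q∣ p∩s⟂⋃ps∩s ⟩
  ∣ p ∩ s ∣ + ∣ ⋃ ps ∩ s ∣    ≡⟨ cong (_+_ ∣ p ∩ s ∣) (∣⋃∩s∣≡sum ps-apart) ⟩
  sum (map (λ p → ∣ p ∩ s ∣) (p ∷ ps)) ∎
  where
  open ≡-Reasoning
  p∩s⟂⋃ps∩s : Disjoint (p ∩ s) (⋃ ps ∩ s)
  p∩s⟂⋃ps∩s = Disjoint-mono (p∩q⊆p p s) (p∩q⊆p (⋃ ps) s) (Disjoint-⋃⁺ p⟂ps)

∃-avoiding : ∀ {L : List (Subset n)} (F : Subset n) → AllPairs Disjoint L → ∣ F ∣ < length L →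
             ∃ λ Y → Y ∈ₗ L × Disjoint Y F
∃-avoiding {L = Y ∷ L} F (Y⟂L ∷ L-apart) (s≤s ∣F∣≤∣L∣) with nonempty? (Y ∩ F)
... | no  Y⟂F           = Y , here refl , Y⟂F
... | yes (x , x∈Y∩F) with x∈Y , x∈F ← x∈p∩q⁻ Y F x∈Y∩F
  with Y′ , Y′∈L , Y′⟂F-x ← ∃-avoiding (F - x) L-apart (<-≤-trans (x∈p⇒∣p-x∣<∣p∣ x∈F) ∣F∣≤∣L∣)
  = Y′ , there Y′∈L , Disjoint-∖ (Disjoint⁻ (All.lookup Y⟂L Y′∈L) x∈Y) Y′⟂F-x

elements : Subset n → List (Fin n)
elements []          = []
elements (true  ∷ p) = zero ∷ map suc (elements p)
elements (false ∷ p) = map suc (elements p)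

length-elements : ∀ (p : Subset n) → length (elements p) ≡ ∣ p ∣
length-elements []          = refl
length-elements (true  ∷ p) = cong suc (trans (length-map suc (elements p)) (length-elements p))
length-elements (false ∷ p) = trans (length-map suc (elements p)) (length-elements p)

∈-elements⁻ : ∀ (p : Subset n) → x ∈ₗ elements p → x ∈ p
∈-elements⁻ (true  ∷ p) (here refl) = here
∈-elements⁻ (true  ∷ p) (there x∈)  with y , y∈ , refl ← ∈-map⁻ suc x∈ = there (∈-elements⁻ p y∈)
∈-elements⁻ (false ∷ p) x∈          with y , y∈ , refl ← ∈-map⁻ suc x∈ = there (∈-elements⁻ p y∈)

elements-unique : ∀ (p : Subset n) → Unique (elements p)
elements-unique []          = []
elements-unique (true  ∷ p) =
  All.map⁺ (All.tabulate λ _ ()) ∷ Unique.map⁺ Fin.suc-injective (elements-unique p)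
elements-unique (false ∷ p) = Unique.map⁺ Fin.suc-injective (elements-unique p)

⋃-map-suc : ∀ (xs : List (Fin n)) → ⋃ (map ⁅_⁆ (map suc xs)) ≡ false ∷ ⋃ (map ⁅_⁆ xs)
⋃-map-suc []       = refl
⋃-map-suc (x ∷ xs) = cong (⁅ suc x ⁆ ∪_) (⋃-map-suc xs)

⋃-elements : ∀ (p : Subset n) → ⋃ (map ⁅_⁆ (elements p)) ≡ p
⋃-elements []          = refl
⋃-elements (true  ∷ p) = trans (cong (⁅ zero ⁆ ∪_) (⋃-map-suc (elements p)))
                               (cong (true ∷_) (trans (∪-identityˡ _) (⋃-elements p)))
⋃-elements (false ∷ p) = trans (⋃-map-suc (elements p)) (cong (false ∷_) (⋃-elements p))

singletons-apart : ∀ (p q : Subset n) → AllPairs Disjoint (q ∷ map ⁅_⁆ (elements (p ─ q)))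
singletons-apart p q =
  All.map⁺ (All.tabulate λ x∈ → Disjoint-sym (Disjoint-⁅⁆ (x∈p─q⇒x∉q p q (∈-elements⁻ (p ─ q) x∈))))
  ∷ AllPairs.map⁺ (AllPairs.map (Disjoint-⁅⁆ ∘ x≢y⇒x∉⁅y⁆) (elements-unique (p ─ q)))

module _ {A : Set} (f g : A → Subset n) where

  ⋃-∷-map-∪ : ∀ a (T : List A) → ⋃ (a ∷ map (λ t → f t ∪ g t) T) ≡ ⋃ (a ∷ map f T) ∪ ⋃ (map g T)
  ⋃-∷-map-∪ a T = trans (cong (a ∪_) (⋃-map-∪ T)) (sym (∪-assoc a _ _))
    where
    open ICM (∪-idempotentCommutativeMonoid n) using (solve; _⊕_; _⊜_)
    interchange : ∀ p q r s → (p ∪ q) ∪ (r ∪ s) ≡ (p ∪ r) ∪ (q ∪ s)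
    interchange = solve 4 (λ p q r s → (p ⊕ q) ⊕ (r ⊕ s) ⊜ (p ⊕ r) ⊕ (q ⊕ s)) refl
    ⋃-map-∪ : ∀ T → ⋃ (map (λ t → f t ∪ g t) T) ≡ ⋃ (map f T) ∪ ⋃ (map g T)
    ⋃-map-∪ []      = sym (∪-identityʳ ⊥)
    ⋃-map-∪ (t ∷ T) = trans (cong ((f t ∪ g t) ∪_) (⋃-map-∪ T)) (interchange (f t) (g t) _ _)

  AllPairs-Disjoint-∪ : ∀ {a} (T : List A) → AllPairs Disjoint (a ∷ map f T) →
                        AllPairs Disjoint (⋃ (a ∷ map f T) ∷ map g T) →
                        AllPairs Disjoint (a ∷ map (λ t → f t ∪ g t) T)
  AllPairs-Disjoint-∪     []      _ _ = [] ∷ []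
  AllPairs-Disjoint-∪ {a} (t ∷ T) (a⟂fs ∷ ft⟂fT ∷ fT-apart) (U⟂gs ∷ gt⟂gT ∷ gT-apart) =
    All.map⁺ (All.zipWith (λ (a⟂f , U⟂g) → Disjoint-∪ʳ a⟂f (Disjoint-mono (p⊆p∪q _) ⊆-refl U⟂g))
                          (All.map⁻ a⟂fs , All.map⁻ U⟂gs))
    ∷ AllPairs-Disjoint-∪ T
        (All.zipWith (λ (ft⟂f , gt⟂f) → Disjoint-∪ˡ ft⟂f gt⟂f) (ft⟂fT , gt⟂fT) ∷ fT-apart)
        (All.zipWith (λ (U⟂g , gt⟂g) → Disjoint-∪ˡ (Disjoint-∪ˡ (Disjoint-mono ft⊆U ⊆-refl U⟂g) gt⟂g)
                                                   (Disjoint-mono ⋃fT⊆U ⊆-refl U⟂g))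
                     (All.tail U⟂gs , gt⟂gT)
         ∷ gT-apart)
    where
    ft⊆U : f t ⊆ ⋃ (a ∷ map f (t ∷ T))
    ft⊆U = q⊆p∪q a _ ∘ p⊆p∪q _
    ⋃fT⊆U : ⋃ (map f T) ⊆ ⋃ (a ∷ map f (t ∷ T))
    ⋃fT⊆U = q⊆p∪q a _ ∘ q⊆p∪q (f t) _
    gt⟂fT : All (Disjoint (g t)) (map f T)
    gt⟂fT = Disjoint-⋃⁻ (Disjoint-sym (Disjoint-mono ⋃fT⊆U ⊆-refl (All.head U⟂gs)))

-- Integer identities

a+b≡c+d⇒a-c≡d-b : ∀ a b c d → a + b ≡ c + d → + a ℤ.- + c ≡ + d ℤ.- + b
a+b≡c+d⇒a-c≡d-b a b c d a+b≡c+d = begin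
  + a ℤ.- + c                     ≡⟨ shift (+ a) (+ b) (+ c) ⟩
  (+ a ℤ.+ + b) ℤ.- + c ℤ.- + b   ≡⟨ cong (λ s → + s ℤ.- + c ℤ.- + b) a+b≡c+d ⟩
  (+ c ℤ.+ + d) ℤ.- + c ℤ.- + b   ≡⟨ unshift (+ c) (+ d) (+ b) ⟩
  + d ℤ.- + b                     ∎
  where
  open ≡-Reasoning
  shift : ∀ A B C → A ℤ.- C ≡ (A ℤ.+ B) ℤ.- C ℤ.- B
  shift = solve-∀
  unshift : ∀ C D B → (C ℤ.+ D) ℤ.- C ℤ.- B ≡ D ℤ.- B
  unshift = solve-∀

sum-linear : ∀ {A : Set} (σ : ℤ) (f g h k : A → ℕ) {T : List A} →
             All (λ t → + f t ℤ.- + g t ≡ σ ℤ.* (+ h t ℤ.- + k t)) T →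
             + sum (map f T) ℤ.- + sum (map g T) ≡ σ ℤ.* (+ sum (map h T) ℤ.- + sum (map k T))
sum-linear σ f g h k []                   = sym (ℤ.*-zeroʳ σ)
sum-linear σ f g h k {t ∷ T} (f-g≡ ∷ rest) = begin
  + (f t + F) ℤ.- + (g t + G)                      ≡⟨ regroup (+ f t) (+ g t) (+ F) (+ G) ⟩
  (+ f t ℤ.- + g t) ℤ.+ (+ F ℤ.- + G)              ≡⟨ cong₂ ℤ._+_ f-g≡ (sum-linear σ f g h k rest) ⟩
  σ ℤ.* (+ h t ℤ.- + k t) ℤ.+ σ ℤ.* (+ H ℤ.- + K)  ≡⟨ factor σ (+ h t) (+ k t) (+ H) (+ K) ⟩
  σ ℤ.* (+ (h t + H) ℤ.- + (k t + K))              ∎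
  where
  open ≡-Reasoning
  F G H K : ℕ
  F = sum (map f T)
  G = sum (map g T)
  H = sum (map h T)
  K = sum (map k T)
  regroup : ∀ a b c d → (a ℤ.+ c) ℤ.- (b ℤ.+ d) ≡ (a ℤ.- b) ℤ.+ (c ℤ.- d)
  regroup = solve-∀
  factor : ∀ s a b c d → s ℤ.* (a ℤ.- b) ℤ.+ s ℤ.* (c ℤ.- d) ≡ s ℤ.* ((a ℤ.+ c) ℤ.- (b ℤ.+ d))
  factor = solve-∀

unscale : ∀ {σ X} A B → σ ≡ 1ℤ ⊎ σ ≡ -1ℤ → X ≡ σ ℤ.* (A ℤ.- B) → A ≡ B ℤ.+ σ ℤ.* X
unscale A B (inj₁ refl) refl = identity A B
  where
  identity : ∀ A B → A ≡ B ℤ.+ 1ℤ ℤ.* (1ℤ ℤ.* (A ℤ.- B))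
  identity = solve-∀
unscale A B (inj₂ refl) refl = identity A B
  where
  identity : ∀ A B → A ≡ B ℤ.+ -1ℤ ℤ.* (-1ℤ ℤ.* (A ℤ.- B))
  identity = solve-∀

-- Unit vectors and roots

𝐞 : ∀ {r} → Fin r → Fin r → ℕ
𝐞 i l = if does (i ≟ l) then 1 else 0

module _ {r : ℕ} where

  private variable
    a b c d i l : Fin r

  𝐞-≡ : i ≡ l → 𝐞 i l ≡ 1
  𝐞-≡ {i = i} {l} i≡l = cong (λ b → if b then 1 else 0) (dec-true (i ≟ l) i≡l)

  𝐞-≢ : i ≢ l → 𝐞 i l ≡ 0
  𝐞-≢ {i = i} {l} i≢l = cong (λ b → if b then 1 else 0) (dec-false (i ≟ l) i≢l)

  root : Fin r → Fin r → Fin r → ℤ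
  root a b l = + 𝐞 a l ℤ.- + 𝐞 b l

  -- root a a is the zero vector, so IsRoot also admits 0
  IsRoot : (Fin r → ℤ) → Set
  IsRoot v = ∃₂ λ a b → ∀ l → v l ≡ root a b l

  root-self : ∀ a (l : Fin r) → root a a l ≡ 0ℤ
  root-self a l = ℤ.+-inverseʳ (+ 𝐞 a l)

  root≢2 : ∀ a b l → root a b l ≢ + 2
  root≢2 a b l with a ≟ l | b ≟ l
  ... | yes _ | yes _ = λ ()
  ... | yes _ | no  _ = λ ()
  ... | no  _ | yes _ = λ ()
  ... | no  _ | no  _ = λ ()

  root≡1⇒head≡ : ∀ a b l → root a b l ≡ + 1 → a ≡ l
  root≡1⇒head≡ a b l eq with a ≟ l | b ≟ l
  root≡1⇒head≡ a b l eq | yes a≡l | _     = a≡l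
  root≡1⇒head≡ a b l () | no  _   | yes _
  root≡1⇒head≡ a b l () | no  _   | no  _

  roots-share-endpoint : a ≢ b → c ≢ d → IsRoot (λ l → root a b l ℤ.- root c d l) → a ≡ c ⊎ b ≡ d
  roots-share-endpoint {a} {b} {c} {d} a≢b c≢d (a′ , b′ , eq) with a ≟ c | b ≟ d
  ... | yes a≡c | _       = inj₁ a≡c
  ... | no  _   | yes b≡d = inj₂ b≡d
  -- coordinate a of the difference is 1 + 𝐞 d a and coordinate d is 1: its head would be both a and d
  ... | no  a≢c | no  b≢d with d ≟ a
  ...   | yes refl = ⊥-elim (root≢2 a′ b′ a (trans (sym (eq a)) at-a))
    where
    at-a : root a b a ℤ.- root c a a ≡ + 2
    at-a rewrite 𝐞-≡ {i = a} refl | 𝐞-≢ (a≢b ∘ sym) | 𝐞-≢ (a≢c ∘ sym) = refl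
  ...   | no  d≢a = ⊥-elim (d≢a (trans (sym (root≡1⇒head≡ a′ b′ d (trans (sym (eq d)) at-d)))
                                       (root≡1⇒head≡ a′ b′ a (trans (sym (eq a)) at-a))))
    where
    at-a : root a b a ℤ.- root c d a ≡ + 1
    at-a rewrite 𝐞-≡ {i = a} refl | 𝐞-≢ (a≢b ∘ sym) | 𝐞-≢ (a≢c ∘ sym) | 𝐞-≢ d≢a = refl
    at-d : root a b d ℤ.- root c d d ≡ + 1
    at-d rewrite 𝐞-≡ {i = d} refl | 𝐞-≢ (d≢a ∘ sym) | 𝐞-≢ b≢d | 𝐞-≢ c≢d = refl

  private
    zeroOrTail : ∀ a b c → a ≡ b ⊎ b ≡ c → ∃ λ p → ∀ l → root a b l ≡ 1ℤ ℤ.* root p c l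
    zeroOrTail a _ c (inj₁ refl) =
      c , λ l → trans (root-self a l) (sym (trans (ℤ.*-identityˡ _) (root-self c l)))
    zeroOrTail a _ _ (inj₂ refl) = a , λ l → sym (ℤ.*-identityˡ _)

    zeroOrHead : ∀ a b c → a ≡ b ⊎ a ≡ c → ∃ λ p → ∀ l → root a b l ≡ -1ℤ ℤ.* root p c l
    zeroOrHead a _ c (inj₁ refl) =
      c , λ l → trans (root-self a l) (sym (cong (-1ℤ ℤ.*_) (root-self c l)))
    zeroOrHead _ b c (inj₂ refl) = b , λ l → negate (+ 𝐞 c l) (+ 𝐞 b l)
      where
      negate : ∀ C B → C ℤ.- B ≡ -1ℤ ℤ.* (B ℤ.- C)
      negate = solve-∀

  module _ {n : ℕ} (a b : Fin n → Fin r)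
           (roots : ∀ x y → IsRoot (λ l → root (a x) (b x) l ℤ.- root (a y) (b y) l)) where

    private
      shareEndpoint : ∀ {x y} → a x ≢ b x → a y ≢ b y → a x ≡ a y ⊎ b x ≡ b y
      shareEndpoint {x} {y} ax≢bx ay≢by = roots-share-endpoint ax≢bx ay≢by (roots x y)

    -- all nonzero 𝐞 (a x) − 𝐞 (b x) share their tail κ (σ = 1), or all share their head κ (σ = -1)
    commonEndpoint : Fin n → ∃₂ λ σ κ → (σ ≡ 1ℤ ⊎ σ ≡ -1ℤ) ×
                     ∀ x → ∃ λ p → ∀ l → root (a x) (b x) l ≡ σ ℤ.* root p κ l
    commonEndpoint x₀ with all? (λ x → a x ≟ b x)
    ... | yes a≡b = 1ℤ , a x₀ , inj₁ refl , λ x → zeroOrTail (a x) (b x) (a x₀) (inj₁ (a≡b x))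
    ... | no  a≢b with x₁ , a₁≢b₁ ← ¬∀⟶∃¬ n _ (λ x → a x ≟ b x) a≢b
                  with all? (λ x → a x ≟ b x ⊎-dec b x ≟ b x₁)
    ...   | yes tails = 1ℤ , b x₁ , inj₁ refl , λ x → zeroOrTail (a x) (b x) (b x₁) (tails x)
    ...   | no  ¬tails with x₂ , ¬[a₂≡b₂⊎b₂≡b₁] ← ¬∀⟶∃¬ n _ (λ x → a x ≟ b x ⊎-dec b x ≟ b x₁) ¬tails
      = -1ℤ , a x₁ , inj₂ refl , λ x → zeroOrHead (a x) (b x) (a x₁) (heads x)
      where
      a₂≢b₂ : a x₂ ≢ b x₂
      a₂≢b₂ = ¬[a₂≡b₂⊎b₂≡b₁] ∘ inj₁
      b₂≢b₁ : b x₂ ≢ b x₁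
      b₂≢b₁ = ¬[a₂≡b₂⊎b₂≡b₁] ∘ inj₂
      a₂≡a₁ : a x₂ ≡ a x₁
      a₂≡a₁ = [ id , ⊥-elim ∘ b₂≢b₁ ] (shareEndpoint a₂≢b₂ a₁≢b₁)
      heads : ∀ x → a x ≡ b x ⊎ a x ≡ a x₁
      heads x with a x ≟ b x
      ... | yes ax≡bx = inj₁ ax≡bx
      ... | no  ax≢bx with shareEndpoint ax≢bx a₁≢b₁
      ...   | inj₁ ax≡a₁ = inj₂ ax≡a₁
      ...   | inj₂ bx≡b₁ with shareEndpoint a₂≢b₂ ax≢bx
      ...     | inj₁ a₂≡ax = inj₂ (trans (sym a₂≡ax) a₂≡a₁)
      ...     | inj₂ b₂≡bx = ⊥-elim (b₂≢b₁ (trans b₂≡bx bx≡b₁))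

    rootSystem : Fin n → ∃₂ λ σ π → (σ ≡ 1ℤ ⊎ σ ≡ -1ℤ) ×
                 ∀ x y l → root (a x) (b x) l ℤ.- root (a y) (b y) l ≡ σ ℤ.* root (π x) (π y) l
    rootSystem x₀ with σ , κ , σ±1 , based ← commonEndpoint x₀ =
      σ , proj₁ ∘ based , σ±1 ,
      λ x y l → trans (cong₂ ℤ._-_ (proj₂ (based x) l) (proj₂ (based y) l))
                      (factor σ (+ 𝐞 (proj₁ (based x)) l) (+ 𝐞 (proj₁ (based y)) l) (+ 𝐞 κ l))
      where
      factor : ∀ s P Q K → s ℤ.* (P ℤ.- K) ℤ.- s ℤ.* (Q ℤ.- K) ≡ s ℤ.* (P ℤ.- Q)
      factor = solve-∀

-- Types of edges

typeOf : ∀ {n r} → (Fin n → Fin r) → Subset n → Fin r → ℤ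
typeOf π e l = + ∣ e ∩ part π l ∣

∣⁅x⁆∩part∣ : ∀ {r} (π : Fin n → Fin r) x l → ∣ ⁅ x ⁆ ∩ part π l ∣ ≡ 𝐞 (π x) l
∣⁅x⁆∩part∣ π zero    l with π zero ≟ l
... | yes _ = cong suc (∣⊥∩p∣≡0 (part (π ∘ suc) l))
... | no  _ = ∣⊥∩p∣≡0 (part (π ∘ suc) l)
∣⁅x⁆∩part∣ π (suc x) l = ∣⁅x⁆∩part∣ (π ∘ suc) x l

∑𝐞 : ∀ {r} (i : Fin r) → ∑[ l < r ] (+ 𝐞 i l) ≡ 1ℤ
∑𝐞 {suc r} zero    = cong (ℤ._+_ 1ℤ) (sum-replicate-zero r)
∑𝐞 {suc r} (suc i) = trans (ℤ.+-identityˡ _) (∑𝐞 i)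

∑-tabulate : ∀ {r} (j : Fin r → ℕ) → + Vec.sum (Vec.tabulate j) ≡ ∑[ l < r ] (+ j l)
∑-tabulate {zero}  j = refl
∑-tabulate {suc r} j = cong (ℤ._+_ (+ j zero)) (∑-tabulate (j ∘ suc))

∑-typeOf : ∀ {r} (π : Fin n → Fin r) p → ∑[ l < r ] (typeOf π p l) ≡ + ∣ p ∣
∑-typeOf {r = r} π []    = sum-replicate-zero r
∑-typeOf π (true  ∷ p) = begin
  ∑[ l < _ ] (typeOf π (true ∷ p) l)
    ≡⟨ sum-cong-≗ split ⟩
  ∑[ l < _ ] (+ 𝐞 (π zero) l ℤ.+ typeOf (π ∘ suc) p l)
    ≡⟨ ∑-distrib-+ (λ l → + 𝐞 (π zero) l) (typeOf (π ∘ suc) p) ⟩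
  ∑[ l < _ ] (+ 𝐞 (π zero) l) ℤ.+ ∑[ l < _ ] (typeOf (π ∘ suc) p l)
    ≡⟨ cong₂ ℤ._+_ (∑𝐞 (π zero)) (∑-typeOf (π ∘ suc) p) ⟩
  + ∣ true ∷ p ∣
    ∎
  where
  open ≡-Reasoning
  split : ∀ l → typeOf π (true ∷ p) l ≡ + 𝐞 (π zero) l ℤ.+ typeOf (π ∘ suc) p l
  split l with π zero ≟ l
  ... | yes _ = refl
  ... | no  _ = refl
∑-typeOf π (false ∷ p) = ∑-typeOf (π ∘ suc) p

shifted-𝐞 : ∀ {r} (j : Fin r → ℕ) σ i l → shifted j σ i l ≡ + j l ℤ.+ σ ℤ.* + 𝐞 i l
shifted-𝐞 j σ i l with i ≟ l
... | yes _ = cong (ℤ._+_ (+ j l)) (sym (ℤ.*-identityʳ σ))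
... | no  _ = sym (trans (cong (ℤ._+_ (+ j l)) (ℤ.*-zeroʳ σ)) (ℤ.+-identityʳ _))

ColoursMatchTypes : ∀ {k n r} → KGraph k n → Colouring n r → ℤ → (Fin n → Fin r) → Set
ColoursMatchTypes H c σ π = ∀ e f → Edge H e → Edge H f → ∀ l →
                            root (c e) (c f) l ≡ σ ℤ.* (typeOf π e l ℤ.- typeOf π f l)

InFstar-from-types : ∀ {k n r} {H : KGraph k n} {c : Colouring n r} → 2 ≤ r →
                     (∀ i → ∃ λ e → Edge H e × c e ≡ i) →
                     (∃₂ λ σ π → (σ ≡ 1ℤ ⊎ σ ≡ -1ℤ) × ColoursMatchTypes H c σ π) →
                     InFstar H c
InFstar-from-types {k} {H = H} {c} (s≤s (s≤s _)) colours (σ , π , σ±1 , coloursMatchTypes) =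
  j , σ , π , (σ±1 , total , j+σ≥0) , typed
  where
  edge : Fin _ → Subset _
  edge i = proj₁ (colours i)
  edge-edge : ∀ i → Edge H (edge i)
  edge-edge i = proj₁ (proj₂ (colours i))
  edge-colour : ∀ i → c (edge i) ≡ i
  edge-colour i = proj₂ (proj₂ (colours i))
  -- an edge whose colour is not l has type exactly j at l
  j : Fin _ → ℕ
  j l = ∣ edge (punchIn l zero) ∩ part π l ∣
  type≡ : ∀ e → Edge H e → ∀ l → typeOf π e l ≡ + j l ℤ.+ σ ℤ.* + 𝐞 (c e) l
  type≡ e e-edge l = unscale (typeOf π e l) (+ j l) σ±1 (begin
    + 𝐞 (c e) l                              ≡⟨ ℤ.+-identityʳ _ ⟨
    + 𝐞 (c e) l ℤ.- + 0                      ≡⟨ cong (λ u → + 𝐞 (c e) l ℤ.- + u) (𝐞-≢ c[e′]≢l) ⟨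
    root (c e) (c e′) l                      ≡⟨ coloursMatchTypes e e′ e-edge (edge-edge _) l ⟩
    σ ℤ.* (typeOf π e l ℤ.- typeOf π e′ l)   ∎)
    where
    open ≡-Reasoning
    e′ : Subset _
    e′ = edge (punchIn l zero)
    c[e′]≢l : c e′ ≢ l
    c[e′]≢l = punchInᵢ≢i l zero ∘ trans (sym (edge-colour _))
  typed : ∀ i e → Edge H e → c e ≡ i → HasType π e (shifted j σ i)
  typed i e e-edge refl l = trans (type≡ e e-edge l) (sym (shifted-𝐞 j σ (c e) l))
  j+σ≥0 : ∀ i → 0ℤ ℤ.≤ + j i ℤ.+ σ
  j+σ≥0 i = subst (0ℤ ℤ.≤_) type≡j+σ (ℤ.+≤+ z≤n)
    where
    type≡j+σ : typeOf π (edge i) i ≡ + j i ℤ.+ σ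
    type≡j+σ = trans (type≡ (edge i) (edge-edge i) i)
                     (cong (ℤ._+_ (+ j i)) (trans (cong (λ u → σ ℤ.* + u) (𝐞-≡ (edge-colour i))) (ℤ.*-identityʳ σ)))
  e₀ : Subset _
  e₀ = edge zero
  total : σ ℤ.+ + Vec.sum (Vec.tabulate j) ≡ + k
  total = begin
    σ ℤ.+ + Vec.sum (Vec.tabulate j)
      ≡⟨ ℤ.+-comm σ _ ⟩
    + Vec.sum (Vec.tabulate j) ℤ.+ σ
      ≡⟨ cong₂ ℤ._+_ (∑-tabulate j) (sym σ∑𝐞) ⟩
    ∑[ l < _ ] (+ j l) ℤ.+ σ ℤ.* ∑[ l < _ ] (+ 𝐞 (c e₀) l)
      ≡⟨ cong (ℤ._+_ (∑[ l < _ ] (+ j l))) (*-distribˡ-sum σ (λ l → + 𝐞 (c e₀) l)) ⟩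
    ∑[ l < _ ] (+ j l) ℤ.+ ∑[ l < _ ] (σ ℤ.* + 𝐞 (c e₀) l)
      ≡⟨ ∑-distrib-+ (λ l → + j l) (λ l → σ ℤ.* + 𝐞 (c e₀) l) ⟨
    ∑[ l < _ ] (+ j l ℤ.+ σ ℤ.* + 𝐞 (c e₀) l)
      ≡⟨ sum-cong-≗ (type≡ e₀ (edge-edge zero)) ⟨
    ∑[ l < _ ] (typeOf π e₀ l)
      ≡⟨ ∑-typeOf π e₀ ⟩
    + ∣ e₀ ∣
      ≡⟨ cong +_ (uniform H e₀ (edge-edge zero)) ⟩
    + k
      ∎
    where
    open ≡-Reasoning
    σ∑𝐞 : σ ℤ.* ∑[ l < _ ] (+ 𝐞 (c e₀) l) ≡ σ
    σ∑𝐞 = trans (cong (ℤ._*_ σ) (∑𝐞 (c e₀))) (ℤ.*-identityʳ σ)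

-- Switchings

module _ {n r : ℕ} (c : Colouring n r) where

  colourCount-∷ : ∀ l e M → colourCount c l (e ∷ M) ≡ 𝐞 (c e) l + colourCount c l M
  colourCount-∷ l e M with does (c e ≟ l)
  ... | true  = refl
  ... | false = refl

  colourCount-map : ∀ {A : Set} l (g : A → Subset n) T →
                    colourCount c l (map g T) ≡ sum (map (λ t → 𝐞 (c (g t)) l) T)
  colourCount-map l g []      = refl
  colourCount-map l g (t ∷ T) =
    trans (colourCount-∷ l (g t) (map g T)) (cong (_+_ (𝐞 (c (g t)) l)) (colourCount-map l g T))

  colourCounts-agree : ∀ {k m} {H : KGraph k n} {M₁ M₂} → NoSwitcherUpTo H c m →
                       IsMatching H M₁ → IsMatching H M₂ → cover M₁ ≡ cover M₂ → ∣ cover M₁ ∣ ≤ m →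
                       ∀ i → colourCount c i M₁ ≡ colourCount c i M₂
  colourCounts-agree {m = m} {M₁ = M₁} {M₂} noSwitcher M₁-matching M₂-matching covers small i
    with <-cmp (colourCount c i M₁) (colourCount c i M₂)
  ... | tri< lt _ _ = ⊥-elim (noSwitcher i M₂ M₁ (M₂-matching , M₁-matching , sym covers , lt)
                                                   (subst (λ s → ∣ s ∣ ≤ m) covers small))
  ... | tri≈ _ eq _ = eq
  ... | tri> _ _ gt = ⊥-elim (noSwitcher i M₁ M₂ (M₁-matching , M₂-matching , covers , gt) small)

record Swap (n : ℕ) : Set where
  constructor swap
  field
    left right : Fin n
    link       : Subset n
open Swap

leftEdge rightEdge : Swap n → Subset n
leftEdge  t = ⁅ left t ⁆ ∪ link t
rightEdge t = ⁅ right t ⁆ ∪ link t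

record CommonNbhd {k n} (H : KGraph k n) (x y : Fin n) (Y : Subset n) : Set where
  constructor _,_
  field
    nbhdˡ : InNbhd H x Y
    nbhdʳ : InNbhd H y Y

module _ {K n r : ℕ} (H : KGraph (suc K) n) (c : Colouring n r) where

  -- T trades e for f: e ∷ map rightEdge T and f ∷ map leftEdge T are matchings
  -- covering the same vertices
  record Switching (e f : Subset n) (T : List (Swap n)) : Set where
    field
      linked      : All (λ t → CommonNbhd H (left t) (right t) (link t)) T
      rightsApart : AllPairs Disjoint (e ∷ map (⁅_⁆ ∘ right) T)
      leftsApart  : AllPairs Disjoint (f ∷ map (⁅_⁆ ∘ left) T)
      linksApart  : AllPairs Disjoint (⋃ (e ∷ map (⁅_⁆ ∘ right) T) ∷ map link T)
      balanced    : ⋃ (e ∷ map (⁅_⁆ ∘ right) T) ≡ ⋃ (f ∷ map (⁅_⁆ ∘ left) T)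
      short       : length T ≤ suc K

  matching-small : ∀ {M} → IsMatching H M → length M ≤ suc (suc K) → ∣ cover M ∣ ≤ suc K * suc K + suc K
  matching-small {M} (edges , _) short = begin
    ∣ cover M ∣            ≤⟨ ∣⋃∣≤length*k (All.map (uniform H _) edges) ⟩
    length M * suc K       ≤⟨ *-monoˡ-≤ (suc K) short ⟩
    suc (suc K) * suc K    ≡⟨ +-comm (suc K) _ ⟩
    suc K * suc K + suc K  ∎
    where open ≤-Reasoning

  switch : ∀ {e f T} → NoSwitcherUpTo H c (suc K * suc K + suc K) → Edge H e → Edge H f →
           Switching e f T → ∀ l →
           root (c e) (c f) l ≡
           + sum (map (λ t → 𝐞 (c (leftEdge t)) l) T) ℤ.- + sum (map (λ t → 𝐞 (c (rightEdge t)) l) T)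
  switch {e} {f} {T} noSwitcher e-edge f-edge S l = a+b≡c+d⇒a-c≡d-b (𝐞 (c e) l) _ (𝐞 (c f) l) _ (begin
    𝐞 (c e) l + sum (map (λ t → 𝐞 (c (rightEdge t)) l) T)
      ≡⟨ colourCount-split e rightEdge ⟨
    colourCount c l M₁
      ≡⟨ colourCounts-agree c {H = H} noSwitcher M₁-matching M₂-matching covers small l ⟩
    colourCount c l M₂
      ≡⟨ colourCount-split f leftEdge ⟩
    𝐞 (c f) l + sum (map (λ t → 𝐞 (c (leftEdge t)) l) T)
      ∎)
    where
    open ≡-Reasoning
    open Switching S
    M₁ M₂ : List (Subset n)
    M₁ = e ∷ map rightEdge T
    M₂ = f ∷ map leftEdge T
    colourCount-split : ∀ a g → colourCount c l (a ∷ map g T) ≡ 𝐞 (c a) l + sum (map (λ t → 𝐞 (c (g t)) l) T)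
    colourCount-split a g = trans (colourCount-∷ c l a (map g T)) (cong (_+_ (𝐞 (c a) l)) (colourCount-map c l g T))
    M₁-matching : IsMatching H M₁
    M₁-matching = e-edge ∷ All.map⁺ (All.map (proj₂ ∘ CommonNbhd.nbhdʳ) linked) ,
                  AllPairs-Disjoint-∪ (⁅_⁆ ∘ right) link T rightsApart linksApart
    M₂-matching : IsMatching H M₂
    M₂-matching = f-edge ∷ All.map⁺ (All.map (proj₂ ∘ CommonNbhd.nbhdˡ) linked) ,
                  AllPairs-Disjoint-∪ (⁅_⁆ ∘ left) link T leftsApart
                    (subst (λ s → AllPairs Disjoint (s ∷ map link T)) balanced linksApart)
    covers : cover M₁ ≡ cover M₂
    covers = begin
      ⋃ M₁                                          ≡⟨ ⋃-∷-map-∪ (⁅_⁆ ∘ right) link e T ⟩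
      ⋃ (e ∷ map (⁅_⁆ ∘ right) T) ∪ ⋃ (map link T)  ≡⟨ cong (_∪ ⋃ (map link T)) balanced ⟩
      ⋃ (f ∷ map (⁅_⁆ ∘ left) T) ∪ ⋃ (map link T)   ≡⟨ ⋃-∷-map-∪ (⁅_⁆ ∘ left) link f T ⟨
      ⋃ M₂                                          ∎
    small : ∣ cover M₁ ∣ ≤ suc K * suc K + suc K
    small = matching-small M₁-matching (s≤s (≤-trans (≤-reflexive (length-map rightEdge T)) short))

  nbhd-∉ : ∀ {x Y} → InNbhd H x Y → x ∉ Y
  nbhd-∉ {x} {Y} (∣Y∣≡K , edge) x∈Y = 1+n≰n (begin
    suc K          ≡⟨ uniform H _ edge ⟨
    ∣ ⁅ x ⁆ ∪ Y ∣  ≤⟨ p⊆q⇒∣p∣≤∣q∣ ⁅x⁆∪Y⊆Y ⟩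
    ∣ Y ∣          ≡⟨ ∣Y∣≡K ⟩
    K              ∎)
    where
    open ≤-Reasoning
    ⁅x⁆∪Y⊆Y : ⁅ x ⁆ ∪ Y ⊆ Y
    ⁅x⁆∪Y⊆Y y∈ = [ (λ y∈⁅x⁆ → subst (_∈ Y) (sym (x∈⁅y⁆⇒x≡y x y∈⁅x⁆)) x∈Y) , id ] (x∈p∪q⁻ ⁅ x ⁆ Y y∈)

  ∣Y∪Y′∣≤K+K : ∀ {x y x′ y′ Y Y′} → CommonNbhd H x y Y → CommonNbhd H x′ y′ Y′ → ∣ Y ∪ Y′ ∣ ≤ K + K
  ∣Y∪Y′∣≤K+K {Y = Y} {Y′} (xY , _) (x′Y′ , _) =
    ≤-trans (∣p∪q∣≤∣p∣+∣q∣ Y Y′) (≤-reflexive (cong₂ _+_ (proj₁ xY) (proj₁ x′Y′)))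

  module _ (1≤K : 1 ≤ K) (noSwitcher : NoSwitcherUpTo H c (suc K * suc K + suc K))
           (rich : ∀ x y → ∃ λ (L : List (Subset n)) → (suc K * suc K ≤ length L) ×
                           AllPairs Disjoint L × All (λ Y → InNbhd H x Y × InNbhd H y Y) L) where

    commonNbhd : ∀ x y (F : Subset n) → ∣ F ∣ < suc K * suc K → ∃ λ Y → CommonNbhd H x y Y × Disjoint Y F
    commonNbhd x y F small with L , many , L-apart , common ← rich x y
      with Y , Y∈L , Y⟂F ← ∃-avoiding F L-apart (<-≤-trans small many) =
      let xY , yY = All.lookup common Y∈L in Y , (xY , yY) , Y⟂F

    ≤1+2K⇒<k² : ∀ {m} → m ≤ suc (K + K) → m < suc K * suc K
    ≤1+2K⇒<k² {m} m≤ = s≤s (begin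
      m                  ≤⟨ m≤ ⟩
      suc (K + K)        ≡⟨ +-suc K K ⟨
      K + suc K          ≤⟨ +-monoʳ-≤ K (≤-trans (≤-reflexive (+-comm 1 K)) (+-monoʳ-≤ K (*-mono-≤ 1≤K 1≤K))) ⟩
      K + (K + K * K)    ≡⟨ cong (_+_ K) (*-suc K K) ⟨
      K + K * suc K      ∎)
      where open ≤-Reasoning

    D : Fin n → Fin n → Subset n → Fin r → ℤ
    D x y Y = root (c (⁅ x ⁆ ∪ Y)) (c (⁅ y ⁆ ∪ Y))

    D-irrelevant-disjoint : ∀ {x y Y Z} → x ≢ y → CommonNbhd H x y Y → CommonNbhd H x y Z → Disjoint Y Z →
                            ∀ l → D x y Y l ≡ D x y Z l
    D-irrelevant-disjoint {x} {y} {Y} {Z} x≢y (xY , yY) (xZ , yZ) Y⟂Z l =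
      trans (switch noSwitcher (proj₂ xY) (proj₂ yY) S l)
            (cong₂ (λ u v → + u ℤ.- + v) (+-identityʳ (𝐞 (c (⁅ x ⁆ ∪ Z)) l)) (+-identityʳ (𝐞 (c (⁅ y ⁆ ∪ Z)) l)))
      where
      open ICM (∪-idempotentCommutativeMonoid n) using (solve; _⊕_; _⊜_) renaming (id to ∅)
      S : Switching (⁅ x ⁆ ∪ Y) (⁅ y ⁆ ∪ Y) (swap x y Z ∷ [])
      S = record
        { linked      = (xZ , yZ) ∷ []
        ; rightsApart = (Disjoint-sym (Disjoint-⁅⁆ (x∉⁅y⁆∪p (x≢y ∘ sym) (nbhd-∉ yY))) ∷ []) ∷ [] ∷ []
        ; leftsApart  = (Disjoint-sym (Disjoint-⁅⁆ (x∉⁅y⁆∪p x≢y (nbhd-∉ xY))) ∷ []) ∷ [] ∷ []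
        ; linksApart  = (Disjoint-∪ˡ (Disjoint-∪ˡ (Disjoint-⁅⁆ (nbhd-∉ xZ)) Y⟂Z)
                                     (Disjoint-∪ˡ (Disjoint-⁅⁆ (nbhd-∉ yZ)) Disjoint-⊥) ∷ []) ∷ [] ∷ []
        ; balanced    = solve 3 (λ x y Y → (x ⊕ Y) ⊕ (y ⊕ ∅) ⊜ (y ⊕ Y) ⊕ (x ⊕ ∅)) refl ⁅ x ⁆ ⁅ y ⁆ Y
        ; short       = s≤s z≤n
        }

    D-irrelevant : ∀ {x y Y Y′} → CommonNbhd H x y Y → CommonNbhd H x y Y′ → ∀ l → D x y Y l ≡ D x y Y′ l
    D-irrelevant {x} {y} {Y} {Y′} xyY xyY′ l with x ≟ y
    ... | yes refl = trans (root-self (c (⁅ x ⁆ ∪ Y)) l) (sym (root-self (c (⁅ x ⁆ ∪ Y′)) l))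
    ... | no  x≢y
      with Z , xyZ , Z⟂Y∪Y′ ← commonNbhd x y (Y ∪ Y′) (≤1+2K⇒<k² (≤-trans (∣Y∪Y′∣≤K+K xyY xyY′) (n≤1+n _))) =
      trans (D-irrelevant-disjoint x≢y xyY  xyZ (Disjoint-sym (Disjoint-mono ⊆-refl (p⊆p∪q Y′) Z⟂Y∪Y′)) l)
            (sym (D-irrelevant-disjoint x≢y xyY′ xyZ (Disjoint-sym (Disjoint-mono ⊆-refl (q⊆p∪q Y Y′) Z⟂Y∪Y′)) l))

    private
      someCommonNbhd : ∀ x y → ∃ λ Y → CommonNbhd H x y Y × Disjoint Y ⊥
      someCommonNbhd x y = commonNbhd x y ⊥ (≤1+2K⇒<k² (≤-trans (≤-reflexive (∣⊥∣≡0 n)) z≤n))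

    Y₀ : Fin n → Fin n → Subset n
    Y₀ x y = proj₁ (someCommonNbhd x y)

    Y₀-common : ∀ x y → CommonNbhd H x y (Y₀ x y)
    Y₀-common x y = proj₁ (proj₂ (someCommonNbhd x y))

    δ : Fin n → Fin n → Fin r → ℤ
    δ x y = D x y (Y₀ x y)

    δ≡D : ∀ {x y Y} → CommonNbhd H x y Y → ∀ l → δ x y l ≡ D x y Y l
    δ≡D = D-irrelevant (Y₀-common _ _)

    δ-self : ∀ x l → δ x x l ≡ 0ℤ
    δ-self x = root-self (c (⁅ x ⁆ ∪ Y₀ x x))

    δ-antisym : ∀ x y l → δ y x l ≡ ℤ.- δ x y l
    δ-antisym x y l = trans (δ≡D (yY , xY) l) (negate (+ 𝐞 (c (⁅ x ⁆ ∪ Y₀ x y)) l) (+ 𝐞 (c (⁅ y ⁆ ∪ Y₀ x y)) l))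
      where
      open CommonNbhd (Y₀-common x y) renaming (nbhdˡ to xY; nbhdʳ to yY)
      negate : ∀ A B → B ℤ.- A ≡ ℤ.- (A ℤ.- B)
      negate = solve-∀

    δ-cocycle : ∀ {x y z} → x ≢ y → x ≢ z → z ≢ y → ∀ l → δ x y l ≡ δ x z l ℤ.+ δ z y l
    δ-cocycle {x} {y} {z} x≢y x≢z z≢y l
      with Y , xyY@(xY , yY) , Y⟂z ← commonNbhd x y ⁅ z ⁆ (≤1+2K⇒<k² (≤-trans (≤-reflexive (∣⁅x⁆∣≡1 z)) (s≤s z≤n)))
      with Y′ , xzY′@(xY′ , zY′) , Y′⟂yY ← commonNbhd x z (⁅ y ⁆ ∪ Y)
             (≤1+2K⇒<k² (≤-trans (∣⁅x⁆∪p∣≤suc∣p∣ y Y) (s≤s (≤-trans (≤-reflexive (proj₁ xY)) (m≤n+m K K)))))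
      with Y″ , zyY″@(zY″ , yY″) , Y″⟂xYY′ ← commonNbhd z y (⁅ x ⁆ ∪ (Y ∪ Y′))
             (≤1+2K⇒<k² (≤-trans (∣⁅x⁆∪p∣≤suc∣p∣ x (Y ∪ Y′)) (s≤s (∣Y∪Y′∣≤K+K xyY xzY′))))
      = begin
        δ x y l
          ≡⟨ δ≡D xyY l ⟩
        D x y Y l
          ≡⟨ switch noSwitcher (proj₂ xY) (proj₂ yY) S l ⟩
        + (𝐞 (c (⁅ x ⁆ ∪ Y′)) l + (𝐞 (c (⁅ z ⁆ ∪ Y″)) l + 0)) ℤ.-
        + (𝐞 (c (⁅ z ⁆ ∪ Y′)) l + (𝐞 (c (⁅ y ⁆ ∪ Y″)) l + 0))
          ≡⟨ regroup (+ 𝐞 (c (⁅ x ⁆ ∪ Y′)) l) (+ 𝐞 (c (⁅ z ⁆ ∪ Y″)) l)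
                     (+ 𝐞 (c (⁅ z ⁆ ∪ Y′)) l) (+ 𝐞 (c (⁅ y ⁆ ∪ Y″)) l) ⟩
        D x z Y′ l ℤ.+ D z y Y″ l
          ≡⟨ cong₂ ℤ._+_ (δ≡D xzY′ l) (δ≡D zyY″ l) ⟨
        δ x z l ℤ.+ δ z y l
          ∎
      where
      open ≡-Reasoning
      open ICM (∪-idempotentCommutativeMonoid n) using (solve; _⊕_; _⊜_) renaming (id to ∅)
      regroup : ∀ A B C D → (A ℤ.+ (B ℤ.+ 0ℤ)) ℤ.- (C ℤ.+ (D ℤ.+ 0ℤ)) ≡ (A ℤ.- C) ℤ.+ (B ℤ.- D)
      regroup = solve-∀
      apart : ∀ {u v Z} → u ≢ v → u ∉ Z → Disjoint (⁅ v ⁆ ∪ Z) ⁅ u ⁆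
      apart u≢v u∉Z = Disjoint-sym (Disjoint-⁅⁆ (x∉⁅y⁆∪p u≢v u∉Z))
      ⁅⁆-apart : ∀ {u v} → u ≢ v → Disjoint ⁅ u ⁆ ⁅ v ⁆
      ⁅⁆-apart u≢v = Disjoint-⁅⁆ (x≢y⇒x∉⁅y⁆ u≢v)
      z∉Y : z ∉ Y
      z∉Y = Disjoint⁻ (Disjoint-sym Y⟂z) (x∈⁅x⁆ z)
      y∉Y′ : y ∉ Y′
      y∉Y′ = Disjoint⁻ (Disjoint-sym Y′⟂yY) (x∈p∪q⁺ (inj₁ (x∈⁅x⁆ y)))
      x∉Y″ : x ∉ Y″
      x∉Y″ = Disjoint⁻ (Disjoint-sym Y″⟂xYY′) (x∈p∪q⁺ (inj₁ (x∈⁅x⁆ x)))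
      Y⟂Y′ : Disjoint Y Y′
      Y⟂Y′ = Disjoint-sym (Disjoint-mono ⊆-refl (q⊆p∪q ⁅ y ⁆ Y) Y′⟂yY)
      Y⟂Y″ : Disjoint Y Y″
      Y⟂Y″ = Disjoint-sym (Disjoint-mono ⊆-refl (q⊆p∪q ⁅ x ⁆ _ ∘ p⊆p∪q Y′) Y″⟂xYY′)
      Y′⟂Y″ : Disjoint Y′ Y″
      Y′⟂Y″ = Disjoint-sym (Disjoint-mono ⊆-refl (q⊆p∪q ⁅ x ⁆ _ ∘ q⊆p∪q Y Y′) Y″⟂xYY′)
      S : Switching (⁅ x ⁆ ∪ Y) (⁅ y ⁆ ∪ Y) (swap x z Y′ ∷ swap z y Y″ ∷ [])
      S = record
        { linked      = xzY′ ∷ zyY″ ∷ []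
        ; rightsApart = (apart (x≢z ∘ sym) z∉Y ∷ apart (x≢y ∘ sym) (nbhd-∉ yY) ∷ []) ∷ (⁅⁆-apart z≢y ∷ []) ∷ [] ∷ []
        ; leftsApart  = (apart x≢y (nbhd-∉ xY) ∷ apart z≢y z∉Y ∷ []) ∷ (⁅⁆-apart x≢z ∷ []) ∷ [] ∷ []
        ; linksApart  =
            (Disjoint-∪ˡ (Disjoint-∪ˡ (Disjoint-⁅⁆ (nbhd-∉ xY′)) Y⟂Y′)
                         (Disjoint-∪ˡ (Disjoint-⁅⁆ (nbhd-∉ zY′)) (Disjoint-∪ˡ (Disjoint-⁅⁆ y∉Y′) Disjoint-⊥))
             ∷ Disjoint-∪ˡ (Disjoint-∪ˡ (Disjoint-⁅⁆ x∉Y″) Y⟂Y″)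
                           (Disjoint-∪ˡ (Disjoint-⁅⁆ (nbhd-∉ zY″)) (Disjoint-∪ˡ (Disjoint-⁅⁆ (nbhd-∉ yY″)) Disjoint-⊥))
             ∷ [])
            ∷ (Y′⟂Y″ ∷ []) ∷ [] ∷ []
        ; balanced    = solve 4 (λ x y z Y → (x ⊕ Y) ⊕ (z ⊕ (y ⊕ ∅)) ⊜ (y ⊕ Y) ⊕ (x ⊕ (z ⊕ ∅))) refl
                                ⁅ x ⁆ ⁅ y ⁆ ⁅ z ⁆ Y
        ; short       = s≤s 1≤K
        }

    δ-via : ∀ w x y l → δ x y l ≡ δ x w l ℤ.- δ y w l
    δ-via w x y l with x ≟ y | x ≟ w | y ≟ w
    ... | yes refl | _        | _        = trans (δ-self x l) (sym (ℤ.+-inverseʳ (δ x w l)))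
    ... | no  _    | yes refl | _        =
      trans (δ-antisym y x l) (sym (trans (cong (ℤ._- δ y x l) (δ-self x l)) (ℤ.+-identityˡ _)))
    ... | no  _    | no  _    | yes refl =
      sym (trans (cong (ℤ._-_ (δ x y l)) (δ-self y l)) (ℤ.+-identityʳ _))
    ... | no  x≢y  | no  x≢w  | no  y≢w  =
      trans (δ-cocycle x≢y x≢w (y≢w ∘ sym) l) (cong (ℤ._+_ (δ x w l)) (δ-antisym y w l))

    δ-via-isRoot : ∀ w x y → IsRoot (λ l → δ x w l ℤ.- δ y w l)
    δ-via-isRoot w x y = c (⁅ x ⁆ ∪ Y₀ x y) , c (⁅ y ⁆ ∪ Y₀ x y) , λ l → sym (δ-via w x y l)

    δ-structure : Fin n → ∃₂ λ σ π → (σ ≡ 1ℤ ⊎ σ ≡ -1ℤ) × ∀ x y l → δ x y l ≡ σ ℤ.* root (π x) (π y) l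
    δ-structure w =
      let σ , π , σ±1 , δ≡ = rootSystem (λ x → c (⁅ x ⁆ ∪ Y₀ x w)) (λ x → c (⁅ w ⁆ ∪ Y₀ x w)) (δ-via-isRoot w) w
      in  σ , π , σ±1 , λ x y l → trans (δ-via w x y l) (δ≡ x y l)

    module _ {e f : Subset n} (e-edge : Edge H e) (f-edge : Edge H f) where

      private
        ∣p-x∣<k : ∀ {p x} → Edge H p → x ∈ p → ∣ p - x ∣ < suc K
        ∣p-x∣<k {p} p-edge x∈p = ≤-trans (x∈p⇒∣p-x∣<∣p∣ x∈p) (≤-reflexive (uniform H p p-edge))

        forbidden-small : ∀ {a b m j} → a < suc K → b < suc K → m + (K + j) ≤ suc K * K →
                          a + (b + m) < suc K * suc K
        forbidden-small {a} {b} {m} {j} (s≤s a≤K) (s≤s b≤K) bound = s≤s (begin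
          a + (b + m)        ≤⟨ +-mono-≤ a≤K (+-mono-≤ b≤K m≤K*K) ⟩
          K + (K + K * K)    ≡⟨ cong (_+_ K) (*-suc K K) ⟨
          K + K * suc K      ∎)
          where
          open ≤-Reasoning
          m≤K*K : m ≤ K * K
          m≤K*K = +-cancelˡ-≤ K m (K * K) (begin
            K + m        ≡⟨ +-comm K m ⟩
            m + K        ≤⟨ +-monoʳ-≤ m (m≤m+n K j) ⟩
            m + (K + j)  ≤⟨ bound ⟩
            K + K * K    ∎)

        prev∪Y-bound : ∀ {prev Y : Subset n} {j} → ∣ Y ∣ ≡ K → ∣ prev ∣ + (K + j) ≤ suc K * K →
                       ∣ prev ∪ Y ∣ + j ≤ suc K * K
        prev∪Y-bound {prev} {Y} {j} ∣Y∣≡K bound = begin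
          ∣ prev ∪ Y ∣ + j        ≤⟨ +-monoˡ-≤ j (∣p∪q∣≤∣p∣+∣q∣ prev Y) ⟩
          ∣ prev ∣ + ∣ Y ∣ + j    ≡⟨ cong (λ m → ∣ prev ∣ + m + j) ∣Y∣≡K ⟩
          ∣ prev ∣ + K + j        ≡⟨ +-assoc ∣ prev ∣ K j ⟩
          ∣ prev ∣ + (K + j)      ≤⟨ bound ⟩
          suc K * K              ∎
          where open ≤-Reasoning

        Placed : Swap n → Set
        Placed t = CommonNbhd H (left t) (right t) (link t) × Disjoint (link t) (e ∪ f)

      -- The links are chosen one pair at a time, avoiding e ∪ f and the union prev of the earlier
      -- links. The bound on prev keeps ∣ prev ∣ ≤ K², so fewer than k² vertices are to be avoided.
      pairUp : ∀ (xs ys : List (Fin n)) → length xs ≡ length ys → All (_∈ e) xs → All (_∈ f) ys →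
               ∀ prev → ∣ prev ∣ + length xs * K ≤ suc K * K →
               ∃ λ T → map left T ≡ xs × map right T ≡ ys × All Placed T × AllPairs Disjoint (prev ∷ map link T)
      pairUp []       []       _   _            _            prev _     = [] , refl , refl , [] , [] ∷ []
      pairUp (x ∷ xs) (y ∷ ys) len (x∈e ∷ xs⊆e) (y∈f ∷ ys⊆f) prev bound
        with Y , xyY@(xY , yY) , Y⟂F ← commonNbhd x y ((e - x) ∪ (f - y) ∪ prev)
               (≤-<-trans (∣p∪q∣≤∣p∣+∣q∣ (e - x) _) (≤-<-trans (+-monoʳ-≤ _ (∣p∪q∣≤∣p∣+∣q∣ (f - y) prev))
                 (forbidden-small (∣p-x∣<k e-edge x∈e) (∣p-x∣<k f-edge y∈f) bound)))
        with T , lefts , rights , placed , prev∪Y⟂links ∷ links-apart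
               ← pairUp xs ys (suc-injective len) xs⊆e ys⊆f (prev ∪ Y) (prev∪Y-bound {prev} {Y} (proj₁ xY) bound)
        = swap x y Y ∷ T , cong (x ∷_) lefts , cong (y ∷_) rights ,
          (xyY , Y⟂e∪f) ∷ placed ,
          (Disjoint-sym Y⟂prev ∷ All.map (Disjoint-mono (p⊆p∪q Y) ⊆-refl) prev∪Y⟂links)
          ∷ All.map (Disjoint-mono (q⊆p∪q prev Y) ⊆-refl) prev∪Y⟂links ∷ links-apart
        where
        Y⟂e∪f : Disjoint Y (e ∪ f)
        Y⟂e∪f = Disjoint-∪ʳ (Disjoint-∖ (nbhd-∉ xY) (Disjoint-mono ⊆-refl (p⊆p∪q _) Y⟂F))
                            (Disjoint-∖ (nbhd-∉ yY) (Disjoint-mono ⊆-refl (q⊆p∪q (e - x) _ ∘ p⊆p∪q prev) Y⟂F))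
        Y⟂prev : Disjoint Y prev
        Y⟂prev = Disjoint-mono ⊆-refl (q⊆p∪q (e - x) _ ∘ q⊆p∪q (f - y) prev) Y⟂F

      switching-exists : ∃ (Switching e f)
      switching-exists = toSwitching (pairUp xs ys same-length (elements⊆ e f) (elements⊆ f e) ⊥ initial)
        where
        xs ys : List (Fin n)
        xs = elements (e ─ f)
        ys = elements (f ─ e)
        elements⊆ : ∀ p q → All (_∈ p) (elements (p ─ q))
        elements⊆ p q = All.tabulate (p─q⊆p p q ∘ ∈-elements⁻ (p ─ q))
        same-length : length xs ≡ length ys
        same-length = begin
          length xs   ≡⟨ length-elements (e ─ f) ⟩
          ∣ e ─ f ∣   ≡⟨ +-cancelˡ-≡ ∣ e ∩ f ∣ _ _ (begin
              ∣ e ∩ f ∣ + ∣ e ─ f ∣  ≡⟨ ∣p∣≡∣p∩q∣+∣p─q∣ e f ⟨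
              ∣ e ∣                  ≡⟨ trans (uniform H e e-edge) (sym (uniform H f f-edge)) ⟩
              ∣ f ∣                  ≡⟨ ∣p∣≡∣p∩q∣+∣p─q∣ f e ⟩
              ∣ f ∩ e ∣ + ∣ f ─ e ∣  ≡⟨ cong (λ s → ∣ s ∣ + ∣ f ─ e ∣) (∩-comm f e) ⟩
              ∣ e ∩ f ∣ + ∣ f ─ e ∣  ∎) ⟩
          ∣ f ─ e ∣   ≡⟨ length-elements (f ─ e) ⟨
          length ys   ∎
          where open ≡-Reasoning
        xs-short : length xs ≤ suc K
        xs-short = ≤-trans (≤-reflexive (length-elements (e ─ f)))
                           (≤-trans (∣p─q∣≤∣p∣ e f) (≤-reflexive (uniform H e e-edge)))
        initial : ∣ ⊥ {n} ∣ + length xs * K ≤ suc K * K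
        initial = ≤-trans (≤-reflexive (cong (_+ length xs * K) (∣⊥∣≡0 n))) (*-monoˡ-≤ K xs-short)
        singletons : ∀ {g : Swap n → Fin n} {T} p q → map g T ≡ elements (p ─ q) →
                     map (⁅_⁆ ∘ g) T ≡ map ⁅_⁆ (elements (p ─ q))
        singletons {T = T} p q g≡ = trans (map-∘ T) (cong (map ⁅_⁆) g≡)
        toSwitching : (∃ λ T → map left T ≡ xs × map right T ≡ ys × All Placed T ×
                               AllPairs Disjoint (⊥ ∷ map link T)) →
                      ∃ (Switching e f)
        toSwitching (T , lefts , rights , placed , _ ∷ links-apart) = T , record
          { linked      = All.map proj₁ placed
          ; rightsApart = subst (λ R → AllPairs Disjoint (e ∷ R)) (sym (singletons f e rights)) (singletons-apart f e)
          ; leftsApart  = subst (λ L → AllPairs Disjoint (f ∷ L)) (sym (singletons e f lefts)) (singletons-apart e f)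
          ; linksApart  = All.map⁺ (All.map (λ (_ , Y⟂e∪f) →
                                      Disjoint-sym (Disjoint-mono ⊆-refl (⊆-reflexive e∪R≡e∪f) Y⟂e∪f)) placed)
                          ∷ links-apart
          ; balanced    = trans e∪R≡e∪f (sym f∪L≡e∪f)
          ; short       = ≤-trans (≤-reflexive (trans (sym (length-map left T)) (cong length lefts))) xs-short
          }
          where
          e∪R≡e∪f : ⋃ (e ∷ map (⁅_⁆ ∘ right) T) ≡ e ∪ f
          e∪R≡e∪f = trans (cong (e ∪_) (trans (cong ⋃ (singletons f e rights)) (⋃-elements (f ─ e))))
                          (p∪[q─p]≡p∪q e f)
          f∪L≡e∪f : ⋃ (f ∷ map (⁅_⁆ ∘ left) T) ≡ e ∪ f
          f∪L≡e∪f = trans (cong (f ∪_) (trans (cong ⋃ (singletons e f lefts)) (⋃-elements (e ─ f))))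
                          (trans (p∪[q─p]≡p∪q f e) (∪-comm f e))

    module _ {σ : ℤ} {π : Fin n → Fin r} (δ≡ : ∀ x y l → δ x y l ≡ σ ℤ.* root (π x) (π y) l) where

      δ-structure⇒ColoursMatchTypes : ColoursMatchTypes H c σ π
      δ-structure⇒ColoursMatchTypes e f e-edge f-edge l with T , S ← switching-exists {e} {f} e-edge f-edge = begin
        root (c e) (c f) l
          ≡⟨ switch noSwitcher e-edge f-edge S l ⟩
        + sum (map (λ t → 𝐞 (c (leftEdge t)) l) T) ℤ.- + sum (map (λ t → 𝐞 (c (rightEdge t)) l) T)
          ≡⟨ sum-linear σ (λ t → 𝐞 (c (leftEdge t)) l) (λ t → 𝐞 (c (rightEdge t)) l)
                          (λ t → ∣ ⁅ left t ⁆ ∩ V ∣) (λ t → ∣ ⁅ right t ⁆ ∩ V ∣) (All.map per-swap linked) ⟩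
        σ ℤ.* (+ sum (map (λ t → ∣ ⁅ left t ⁆ ∩ V ∣) T) ℤ.- + sum (map (λ t → ∣ ⁅ right t ⁆ ∩ V ∣) T))
          ≡⟨ cong (ℤ._*_ σ) (a+b≡c+d⇒a-c≡d-b (∣ e ∩ V ∣) _ (∣ f ∩ V ∣) _ types) ⟨
        σ ℤ.* (typeOf π e l ℤ.- typeOf π f l)
          ∎
        where
        open ≡-Reasoning
        open Switching S
        V : Subset n
        V = part π l
        per-swap : ∀ {t} → CommonNbhd H (left t) (right t) (link t) →
                   + 𝐞 (c (leftEdge t)) l ℤ.- + 𝐞 (c (rightEdge t)) l ≡
                   σ ℤ.* (+ ∣ ⁅ left t ⁆ ∩ V ∣ ℤ.- + ∣ ⁅ right t ⁆ ∩ V ∣)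
        per-swap {t} linked-t = begin
          D (left t) (right t) (link t) l          ≡⟨ δ≡D linked-t l ⟨
          δ (left t) (right t) l                   ≡⟨ δ≡ (left t) (right t) l ⟩
          σ ℤ.* root (π (left t)) (π (right t)) l
            ≡⟨ cong (ℤ._*_ σ) (cong₂ (λ u v → + u ℤ.- + v) (∣⁅x⁆∩part∣ π (left t) l) (∣⁅x⁆∩part∣ π (right t) l)) ⟨
          σ ℤ.* (+ ∣ ⁅ left t ⁆ ∩ V ∣ ℤ.- + ∣ ⁅ right t ⁆ ∩ V ∣) ∎
        types : ∣ e ∩ V ∣ + sum (map (λ t → ∣ ⁅ right t ⁆ ∩ V ∣) T) ≡
                ∣ f ∩ V ∣ + sum (map (λ t → ∣ ⁅ left t ⁆ ∩ V ∣) T)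
        types = begin
          ∣ e ∩ V ∣ + sum (map (λ t → ∣ ⁅ right t ⁆ ∩ V ∣) T)   ≡⟨ cong (λ s → ∣ e ∩ V ∣ + sum s) (map-∘ T) ⟩
          sum (map (λ p → ∣ p ∩ V ∣) (e ∷ map (⁅_⁆ ∘ right) T))  ≡⟨ ∣⋃∩s∣≡sum rightsApart ⟨
          ∣ ⋃ (e ∷ map (⁅_⁆ ∘ right) T) ∩ V ∣                   ≡⟨ cong (λ s → ∣ s ∩ V ∣) balanced ⟩
          ∣ ⋃ (f ∷ map (⁅_⁆ ∘ left) T) ∩ V ∣                    ≡⟨ ∣⋃∩s∣≡sum leftsApart ⟩
          sum (map (λ p → ∣ p ∩ V ∣) (f ∷ map (⁅_⁆ ∘ left) T))   ≡⟨ cong (λ s → ∣ f ∩ V ∣ + sum s) (map-∘ T) ⟨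
          ∣ f ∩ V ∣ + sum (map (λ t → ∣ ⁅ left t ⁆ ∩ V ∣) T)    ∎

    colours-match-types : Fin n → ∃₂ λ σ π → (σ ≡ 1ℤ ⊎ σ ≡ -1ℤ) × ColoursMatchTypes H c σ π
    colours-match-types w =
      let σ , π , σ±1 , δ≡ = δ-structure w in σ , π , σ±1 , δ-structure⇒ColoursMatchTypes {σ} {π} δ≡

lemma2p1 : (k r n : ℕ) → 2 ≤ k → 2 ≤ r → (H : KGraph k n) →
    (∀ (x y : Fin n) → Σ (List (Subset n)) λ L →
        (k * k ≤ length L) × AllPairs Disjoint L ×
        All (λ Y → InNbhd H x Y × InNbhd H y Y) L) →
    (c : Colouring n r) →
    (∀ (i : Fin r) → Σ (Subset n) λ e → Edge H e × c e ≡ i) →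
    NoSwitcherUpTo H c (k * k + k) →
    InFstar H c
lemma2p1 k r n (s≤s 1≤K) 2≤r@(s≤s _) H rich c colours noSwitcher =
  InFstar-from-types {H = H} {c} 2≤r colours (colours-match-types H c 1≤K noSwitcher rich w)
  where
  w : Fin n
  w with e , e-edge , _ ← colours zero = proj₁ (∣p∣≡suc⇒Nonempty e (uniform H e e-edge))
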